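{- Let $G$ be a finite simple graph with $|G|$ vertices. Then \[ \hat Z(G) = |G| - \min\{ \operatorname{tri}(\mathcal A) : \mathcal A \in \mathcal{S}_{\mathrm{znz}}(G) \}. \]
   Context: A zero-nonzero pattern is a matrix with entries in $\{0,*\}$. A square pattern is a triangle if some permutation of its rows followed by some independent permutation of its columns yields a lower-triangular pattern with only $*$ entries on its diagonal. The triangle number $\operatorname{tri}(\mathcal{Y})$ of a pattern $\mathcal{Y}$ is the largest size of a square submatrix of $\mathcal{Y}$ that is a triangle. For a simple graph $G$ with vertex set $V(G)$, $\mathcal{S}_{\mathrm{znz}}(G)$ is the set of the $2^{|G|}$ symmetric $V(G)\times V(G)$ zero-nonzero patterns whose off-diagonal $(i,j)$ entry is $*$ exactly when $\{i,j\}$ is an edge of $G$ and whose diagonal entries are arbitrary. A looping of $G$ is a loop graph obtained from $G$ by adding loops at some of its vertices. In a loop graph with some vertices filled, the loop zero forcing rule says: a vertex $v$ (filled or not) may force (fill) a vertex $u$ if $u$ is the only unfilled neighbor of $v$ (a vertex with a loop is its own neighbor). A loop zero forcing set is a set of initially filled vertices from which repeated application of this rule fills every vertex; the zero forcing number of a loop graph is the smallest size of a loop zero forcing set. The enhanced zero forcing number $\hat Z(G)$ is the maximum, over all loopings $\hat G$ of $G$, of the zero forcing number of $\hat G$. -}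

module Defs where

open import Data.Nat using (ℕ; _≤_; _∸_)
open import Data.Bool using (Bool; true; false)
open import Data.Fin using (Fin; _<_)
open import Data.Fin.Subset using (Subset; _∈_; _∉_; ⁅_⁆; _∪_; ∣_∣; ⊤)
open import Data.Fin.Permutation using (Permutation′; _⟨$⟩ʳ_)
open import Data.Product using (Σ; _×_; ∃; ∃-syntax)
open import Data.Sum using (_⊎_)
open import Function.Definitions using (Injective)
open import Relation.Binary.PropositionalEquality using (_≡_; _≢_)

record SimpleGraph (n : ℕ) : Set where
  field
    adj   : Fin n → Fin n → Bool
    sym   : ∀ i j → adj i j ≡ adj j i
    irrefl : ∀ i → adj i i ≡ false
open SimpleGraph public

-- Zero-nonzero patterns: true = *, false = 0.  An m × k pattern is a
-- function Fin m → Fin k → Bool.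

Pattern : ℕ → ℕ → Set
Pattern m k = Fin m → Fin k → Bool

LowerTriangularStarDiag : ∀ {k} → Pattern k k → Set
LowerTriangularStarDiag {k} B =
  (∀ i → B i i ≡ true) × (∀ (i j : Fin k) → i < j → B i j ≡ false)

IsTriangle : ∀ {k} → Pattern k k → Set
IsTriangle {k} B =
  Σ (Permutation′ k) λ σ → Σ (Permutation′ k) λ τ →
    LowerTriangularStarDiag {k} (λ i j → B (σ ⟨$⟩ʳ i) (τ ⟨$⟩ʳ j))

Submatrix : ∀ {m n} → Pattern m n → (k : ℕ) →
            (r : Fin k → Fin m) → (c : Fin k → Fin n) → Pattern k k
Submatrix A k r c i j = A (r i) (c j)

HasTriangleOfSize : ∀ {m n} → Pattern m n → ℕ → Set
HasTriangleOfSize {m} {n} A k =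
  Σ (Fin k → Fin m) λ r → Σ (Fin k → Fin n) λ c →
    Injective _≡_ _≡_ r × Injective _≡_ _≡_ c × IsTriangle (Submatrix A k r c)

IsTriangleNumber : ∀ {m n} → Pattern m n → ℕ → Set
IsTriangleNumber A t = HasTriangleOfSize A t × (∀ k → HasTriangleOfSize A k → k ≤ t)

InSznz : ∀ {n} → SimpleGraph n → Pattern n n → Set
InSznz {n} G A = (∀ i j → A i j ≡ A j i) × (∀ i j → i ≢ j → A i j ≡ adj G i j)

IsMinTri : ∀ {n} → SimpleGraph n → ℕ → Set
IsMinTri {n} G m =
  (Σ (Pattern n n) λ A → InSznz G A × IsTriangleNumber A m) ×
  (∀ (A : Pattern n n) t → InSznz G A → IsTriangleNumber A t → m ≤ t)

-- a looping of G: loop at vertex v iff ℓ v ≡ true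
Looping : ℕ → Set
Looping n = Fin n → Bool

Nbr : ∀ {n} → SimpleGraph n → Looping n → Fin n → Fin n → Set
Nbr G ℓ v u = adj G v u ≡ true ⊎ (u ≡ v × ℓ v ≡ true)

ForceStep : ∀ {n} → SimpleGraph n → Looping n → Subset n → Subset n → Set
ForceStep {n} G ℓ S S' =
  Σ (Fin n) λ v → Σ (Fin n) λ u →
    u ∉ S × Nbr G ℓ v u × (∀ w → Nbr G ℓ v w → w ≢ u → w ∈ S) ×
    S' ≡ S ∪ ⁅ u ⁆

data Forces {n} (G : SimpleGraph n) (ℓ : Looping n) : Subset n → Subset n → Set where
  done : ∀ {S} → Forces G ℓ S S
  step : ∀ {S S' T} → ForceStep G ℓ S S' → Forces G ℓ S' T → Forces G ℓ S T

IsLoopZFS : ∀ {n} → SimpleGraph n → Looping n → Subset n → Set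
IsLoopZFS G ℓ S = Forces G ℓ S ⊤

IsZeroForcingNumber : ∀ {n} → SimpleGraph n → Looping n → ℕ → Set
IsZeroForcingNumber {n} G ℓ z =
  (Σ (Subset n) λ S → IsLoopZFS G ℓ S × ∣ S ∣ ≡ z) ×
  (∀ S → IsLoopZFS G ℓ S → z ≤ ∣ S ∣)

IsEnhancedZ : ∀ {n} → SimpleGraph n → ℕ → Set
IsEnhancedZ {n} G z =
  (Σ (Looping n) λ ℓ → IsZeroForcingNumber G ℓ z) ×
  (∀ (ℓ : Looping n) z' → IsZeroForcingNumber G ℓ z' → z' ≤ z)

{-# OPTIONS --safe #-}
module Submission where

-- Fix a looping ℓ of G and let A be the pattern in S_znz(G) with diagonal ℓ, so that the nonzero
-- entries of A are exactly the adjacencies of the loop graph. A chain of forces v₁ → u₁, …, v_k → u_k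
-- from a set S lists the rows and columns of a k × k triangle of A in lower-triangular order: when
-- vᵢ forces uᵢ, every later uⱼ is still unfilled, so A(vᵢ, uⱼ) = 0. Conversely, row i of a triangle
-- in that order forces column i, starting from the complement of its columns. Since a full chain
-- from S has n − |S| forces, Z(G, ℓ) = n − tri(A); maximising over ℓ, i.e. over the diagonals of
-- the patterns in S_znz(G), gives the theorem.

open import Defs hiding (sym)
open import Data.Nat using (ℕ; _∸_; zero; suc; _+_; _≤_; z≤n; s≤s)
open import Data.Nat.Properties
  using ( ≤-refl; ≤-reflexive; ≤-trans; ≤-total; ≤-antisym; +-identityʳ; +-suc
        ; m+n∸m≡n; m+[n∸m]≡n; m∸[m∸n]≡n; ∸-monoʳ-≤)
  renaming (_≟_ to _≟ℕ_)
open import Data.Bool using (Bool; true; false; if_then_else_)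
open import Data.Bool.Properties using (∨-identityʳ; ¬-not; not-¬) renaming (_≟_ to _≟ᴮ_)
open import Data.Empty using (⊥-elim)
open import Data.Fin using (Fin; zero; suc; _<_)
open import Data.Fin.Properties using (<-cmp; 0≢1+n; any?; all?) renaming (_≟_ to _≟ᶠ_)
open import Data.Fin.Permutation using (_⟨$⟩ʳ_) renaming (id to idₚ)
open import Data.Fin.Subset using (Subset; _∈_; _∉_; ⁅_⁆; _∪_; _-_; ∣_∣; ⊤)
open import Data.Fin.Subset.Properties
  using (_∈?_; ∈⊤; x∈⁅x⁆; p⊆p∪q; q⊆p∪q; ∪-identityʳ; p─⊥≡p; x∈p∧x≢y⇒x∈p-y; ∣⊤∣≡n; ∣p∣≤n; ∣p∣≡n⇒p≡⊤; anySubset?)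
open import Data.Product using (Σ; _×_; _,_; proj₁; proj₂)
open import Data.Sum using (inj₁; inj₂)
open import Data.Vec.Properties using (≡-dec)
open import Function using (_∘_)
open import Function.Definitions using (Injective)
open import Relation.Binary.Definitions using (tri<; tri≈; tri>)
open import Relation.Binary.PropositionalEquality
  using (_≡_; refl; sym; trans; cong; cong₂; subst; _≢_; _≗_; module ≡-Reasoning)
open import Relation.Nullary using (Dec; yes; no; ¬?; does)
open import Relation.Nullary.Decidable using (map′; dec-true; dec-false; _×-dec_; _⊎-dec_; _→-dec_)

private
  variable
    m n k : ℕ

-- Data.Vec's _∷_ is scoped to this block; elsewhere _∷_ is the cons of Data.Vec.Functional.
module _ where
  open import Data.Vec using (_∷_; here; there)

  x∉p-x : ∀ (p : Subset n) x → x ∉ p - x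
  x∉p-x (_ ∷ p) zero    ()
  x∉p-x (_ ∷ p) (suc x) (there x∈p-x) = x∉p-x p x x∈p-x

  x∈p⇒[p-x]∪⁅x⁆≡p : ∀ {p : Subset n} {x} → x ∈ p → (p - x) ∪ ⁅ x ⁆ ≡ p
  x∈p⇒[p-x]∪⁅x⁆≡p {p = _ ∷ p} here = cong (true ∷_) (trans (∪-identityʳ _) (p─⊥≡p p))
  x∈p⇒[p-x]∪⁅x⁆≡p {p = b ∷ p} (there x∈p) = cong₂ _∷_ (∨-identityʳ b) (x∈p⇒[p-x]∪⁅x⁆≡p x∈p)

  x∉p⇒∣p∪⁅x⁆∣≡1+∣p∣ : ∀ (p : Subset n) x → x ∉ p → ∣ p ∪ ⁅ x ⁆ ∣ ≡ suc ∣ p ∣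
  x∉p⇒∣p∪⁅x⁆∣≡1+∣p∣ (true  ∷ p) zero    x∉p = ⊥-elim (x∉p here)
  x∉p⇒∣p∪⁅x⁆∣≡1+∣p∣ (false ∷ p) zero    x∉p = cong (suc ∘ ∣_∣) (∪-identityʳ p)
  x∉p⇒∣p∪⁅x⁆∣≡1+∣p∣ (true  ∷ p) (suc x) x∉p = cong suc (x∉p⇒∣p∪⁅x⁆∣≡1+∣p∣ p x (x∉p ∘ there))
  x∉p⇒∣p∪⁅x⁆∣≡1+∣p∣ (false ∷ p) (suc x) x∉p = x∉p⇒∣p∪⁅x⁆∣≡1+∣p∣ p x (x∉p ∘ there)

open import Data.Vec.Functional using ([]; _∷_; head; tail)
open import Data.Vec.Functional.Properties using (∷-cong)

least-witness : (P : ℕ → Set) → (∀ s → Dec (P s)) → P m → Σ ℕ λ s → P s × (∀ s' → P s' → s ≤ s')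
least-witness {zero} P P? p₀ = zero , p₀ , λ _ _ → z≤n
least-witness {suc m} P P? pₘ with P? zero
... | yes p₀ = zero , p₀ , λ _ _ → z≤n
... | no ¬p₀ with least-witness (P ∘ suc) (P? ∘ suc) pₘ
...   | s , pₛ , least = suc s , pₛ , λ { zero p₀ → ⊥-elim (¬p₀ p₀) ; (suc s') p → s≤s (least s' p) }

argmax-Bool : (g : Bool → ℕ) → Σ Bool λ b₀ → ∀ b → g b ≤ g b₀
argmax-Bool g with ≤-total (g false) (g true)
... | inj₁ f≤t = true , λ { false → f≤t ; true → ≤-refl }
... | inj₂ t≤f = false , λ { false → ≤-refl ; true → t≤f }

argmax-Fin→Bool : ∀ n (F : (Fin n → Bool) → ℕ) → (∀ {ℓ ℓ'} → ℓ ≗ ℓ' → F ℓ ≡ F ℓ') →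
                  Σ (Fin n → Bool) λ ℓ₀ → ∀ ℓ → F ℓ ≤ F ℓ₀
argmax-Fin→Bool zero F F-cong = [] , λ ℓ → ≤-reflexive (F-cong λ ())
argmax-Fin→Bool (suc n) F F-cong = b₀ ∷ best b₀ , λ ℓ → ≤-trans (≤-best ℓ) (b₀-max (head ℓ))
  where
  argmax-from : ∀ b → Σ (Fin n → Bool) λ t₀ → ∀ t → F (b ∷ t) ≤ F (b ∷ t₀)
  argmax-from b = argmax-Fin→Bool n (F ∘ (b ∷_)) (λ t≗t' → F-cong (∷-cong refl t≗t'))
  best : Bool → Fin n → Bool
  best b = proj₁ (argmax-from b)
  b₀ : Bool
  b₀ = proj₁ (argmax-Bool λ b → F (b ∷ best b))
  b₀-max : ∀ b → F (b ∷ best b) ≤ F (b₀ ∷ best b₀)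
  b₀-max = proj₂ (argmax-Bool λ b → F (b ∷ best b))
  ≤-best : ∀ ℓ → F ℓ ≤ F (head ℓ ∷ best (head ℓ))
  ≤-best ℓ = ≤-trans (≤-reflexive (F-cong {ℓ} (∷-cong refl λ _ → refl))) (proj₂ (argmax-from (head ℓ)) (tail ℓ))

module _ {G : SimpleGraph n} {ℓ : Looping n} where

  steps : ∀ {S T} → Forces G ℓ S T → ℕ
  steps done       = zero
  steps (step _ F) = suc (steps F)

  ∣S∣+steps≡∣T∣ : ∀ {S T} (F : Forces G ℓ S T) → ∣ S ∣ + steps F ≡ ∣ T ∣
  ∣S∣+steps≡∣T∣ done = +-identityʳ _
  ∣S∣+steps≡∣T∣ {S} (step (_ , u , u∉S , _ , _ , refl) F) = begin
    ∣ S ∣ + suc (steps F)   ≡⟨ +-suc ∣ S ∣ (steps F) ⟩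
    suc ∣ S ∣ + steps F     ≡⟨ cong (_+ steps F) (sym (x∉p⇒∣p∪⁅x⁆∣≡1+∣p∣ S u u∉S)) ⟩
    ∣ S ∪ ⁅ u ⁆ ∣ + steps F ≡⟨ ∣S∣+steps≡∣T∣ F ⟩
    _                       ∎
    where open ≡-Reasoning

  steps≡n∸∣S∣ : ∀ {S} (F : Forces G ℓ S ⊤) → steps F ≡ n ∸ ∣ S ∣
  steps≡n∸∣S∣ {S} F = begin
    steps F                   ≡⟨ m+n∸m≡n ∣ S ∣ (steps F) ⟨
    ∣ S ∣ + steps F ∸ ∣ S ∣   ≡⟨ cong (_∸ ∣ S ∣) (∣S∣+steps≡∣T∣ F) ⟩
    ∣ ⊤ {n} ∣ ∸ ∣ S ∣         ≡⟨ cong (_∸ ∣ S ∣) (∣⊤∣≡n n) ⟩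
    n ∸ ∣ S ∣                 ∎
    where open ≡-Reasoning

module _ (G : SimpleGraph n) (ℓ : Looping n) where

  CanForce : Subset n → Fin n → Fin n → Set
  CanForce S v u = u ∉ S × Nbr G ℓ v u × (∀ w → Nbr G ℓ v w → w ≢ u → w ∈ S)

  nbr? : ∀ v u → Dec (Nbr G ℓ v u)
  nbr? v u = (adj G v u ≟ᴮ true) ⊎-dec ((u ≟ᶠ v) ×-dec (ℓ v ≟ᴮ true))

  canForce? : ∀ S v u → Dec (CanForce S v u)
  canForce? S v u =
    ¬? (u ∈? S) ×-dec nbr? v u ×-dec all? (λ w → nbr? v w →-dec ¬? (w ≟ᶠ u) →-dec w ∈? S)

  -- The fuel f is the number of unfilled vertices, which each force lowers by one.
  forces⊤? : ∀ f S → ∣ S ∣ + f ≡ n → Dec (Forces G ℓ S ⊤)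
  forceThen? : ∀ f S → ∣ S ∣ + suc f ≡ n → ∀ v u → Dec (CanForce S v u × Forces G ℓ (S ∪ ⁅ u ⁆) ⊤)

  forces⊤? zero S ∣S∣≡n rewrite ∣p∣≡n⇒p≡⊤ {p = S} (trans (sym (+-identityʳ ∣ S ∣)) ∣S∣≡n) = yes done
  forces⊤? (suc f) S ∣S∣+1+f≡n with ≡-dec _≟ᴮ_ S ⊤
  ... | yes refl = yes done
  ... | no S≢⊤ = map′ fromForce toForce (any? λ v → any? λ u → forceThen? f S ∣S∣+1+f≡n v u)
    where
    fromForce : (Σ (Fin n) λ v → Σ (Fin n) λ u → CanForce S v u × Forces G ℓ (S ∪ ⁅ u ⁆) ⊤) → Forces G ℓ S ⊤
    fromForce (v , u , (u∉S , v~u , forced) , F) = step (v , u , u∉S , v~u , forced , refl) F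
    toForce : Forces G ℓ S ⊤ → Σ (Fin n) λ v → Σ (Fin n) λ u → CanForce S v u × Forces G ℓ (S ∪ ⁅ u ⁆) ⊤
    toForce done = ⊥-elim (S≢⊤ refl)
    toForce (step (v , u , u∉S , v~u , forced , refl) F) = v , u , (u∉S , v~u , forced) , F

  forceThen? f S ∣S∣+1+f≡n v u with canForce? S v u
  ... | no ¬can = no (¬can ∘ proj₁)
  ... | yes can@(u∉S , _) = map′ (can ,_) proj₂ (forces⊤? f (S ∪ ⁅ u ⁆) size-∪)
    where
    size-∪ : ∣ S ∪ ⁅ u ⁆ ∣ + f ≡ n
    size-∪ = trans (cong (_+ f) (x∉p⇒∣p∪⁅x⁆∣≡1+∣p∣ S u u∉S)) (trans (sym (+-suc ∣ S ∣ f)) ∣S∣+1+f≡n)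

  isLoopZFS? : ∀ S → Dec (IsLoopZFS G ℓ S)
  isLoopZFS? S = forces⊤? (n ∸ ∣ S ∣) S (m+[n∸m]≡n (∣p∣≤n S))

  zeroForcingNumber-exists : Σ ℕ (IsZeroForcingNumber G ℓ)
  zeroForcingNumber-exists with least-witness ForcingSetOfSize forcingSetOfSize? (⊤ , done , ∣⊤∣≡n n)
    where
    ForcingSetOfSize : ℕ → Set
    ForcingSetOfSize s = Σ (Subset n) λ S → IsLoopZFS G ℓ S × ∣ S ∣ ≡ s
    forcingSetOfSize? : ∀ s → Dec (ForcingSetOfSize s)
    forcingSetOfSize? s = anySubset? λ S → isLoopZFS? S ×-dec (∣ S ∣ ≟ℕ s)
  ... | z , zfs , least = z , zfs , λ S F → least ∣ S ∣ (S , F , refl)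

zeroForcingNumber-unique : ∀ {G : SimpleGraph n} {ℓ z z'} →
                           IsZeroForcingNumber G ℓ z → IsZeroForcingNumber G ℓ z' → z ≡ z'
zeroForcingNumber-unique ((S , F , ∣S∣≡z) , z-min) ((S' , F' , ∣S'∣≡z') , z'-min) =
  ≤-antisym (subst (_ ≤_) ∣S'∣≡z' (z-min S' F')) (subst (_ ≤_) ∣S∣≡z (z'-min S F))

triangleNumber-unique : ∀ {A : Pattern m n} {t t'} → IsTriangleNumber A t → IsTriangleNumber A t' → t ≡ t'
triangleNumber-unique (tri-t , t-max) (tri-t' , t'-max) = ≤-antisym (t'-max _ tri-t) (t-max _ tri-t')

Nbr-cong : ∀ (G : SimpleGraph n) {ℓ ℓ'} → ℓ ≗ ℓ' → ∀ {v u} → Nbr G ℓ v u → Nbr G ℓ' v u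
Nbr-cong G ℓ≗ℓ' (inj₁ v~u)            = inj₁ v~u
Nbr-cong G ℓ≗ℓ' (inj₂ (u≡v , loop-v)) = inj₂ (u≡v , trans (sym (ℓ≗ℓ' _)) loop-v)

Forces-cong : ∀ {G : SimpleGraph n} {ℓ ℓ' S T} → ℓ ≗ ℓ' → Forces G ℓ S T → Forces G ℓ' S T
Forces-cong ℓ≗ℓ' done = done
Forces-cong {G = G} ℓ≗ℓ' (step (v , u , u∉S , v~u , forced , S'≡) F) =
  step (v , u , u∉S , Nbr-cong G ℓ≗ℓ' v~u , (λ w → forced w ∘ Nbr-cong G (sym ∘ ℓ≗ℓ')) , S'≡) (Forces-cong ℓ≗ℓ' F)

zeroForcingNumber-cong : ∀ {G : SimpleGraph n} {ℓ ℓ' z} → ℓ ≗ ℓ' →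
                         IsZeroForcingNumber G ℓ z → IsZeroForcingNumber G ℓ' z
zeroForcingNumber-cong ℓ≗ℓ' ((S , F , ∣S∣≡z) , z-min) =
  (S , Forces-cong ℓ≗ℓ' F , ∣S∣≡z) , λ S' F' → z-min S' (Forces-cong (sym ∘ ℓ≗ℓ') F')

record Triangular (A : Pattern m n) (r : Fin k → Fin m) (c : Fin k → Fin n) : Set where
  constructor triangular
  field
    diag  : ∀ i → A (r i) (c i) ≡ true
    upper : ∀ i j → i < j → A (r i) (c j) ≡ false

module _ {A : Pattern m n} where

  Triangular-∷ : ∀ {r : Fin k → Fin m} {c v u} → A v u ≡ true → (∀ j → A v (c j) ≡ false) →
                 Triangular A r c → Triangular A (v ∷ r) (u ∷ c)
  Triangular-∷ A[v,u]≡* A[v,c]≡0 (triangular diag upper) = triangular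
    (λ { zero → A[v,u]≡* ; (suc i) → diag i })
    λ { zero zero () ; zero (suc j) _ → A[v,c]≡0 j ; (suc i) zero () ; (suc i) (suc j) (s≤s i<j) → upper i j i<j }

  Triangular-tail : ∀ {r : Fin (suc k) → Fin m} {c} → Triangular A r c → Triangular A (tail r) (tail c)
  Triangular-tail (triangular diag upper) = triangular (diag ∘ suc) λ i j i<j → upper (suc i) (suc j) (s≤s i<j)

  Triangular⇒rows-injective : ∀ {r : Fin k → Fin m} {c} → Triangular A r c → Injective _≡_ _≡_ r
  Triangular⇒rows-injective {c = c} (triangular diag upper) {i} {j} rᵢ≡rⱼ with <-cmp i j
  ... | tri< i<j _ _ = ⊥-elim (not-¬ (subst (λ x → A x (c j) ≡ true) (sym rᵢ≡rⱼ) (diag j)) (upper i j i<j))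
  ... | tri≈ _ i≡j _ = i≡j
  ... | tri> _ _ j<i = ⊥-elim (not-¬ (subst (λ x → A x (c i) ≡ true) rᵢ≡rⱼ (diag i)) (upper j i j<i))

  Triangular⇒cols-injective : ∀ {r : Fin k → Fin m} {c} → Triangular A r c → Injective _≡_ _≡_ c
  Triangular⇒cols-injective {r = r} {c} (triangular diag upper) {i} {j} cᵢ≡cⱼ with <-cmp i j
  ... | tri< i<j _ _ = ⊥-elim (not-¬ (subst (λ x → A (r i) x ≡ true) cᵢ≡cⱼ (diag i)) (upper i j i<j))
  ... | tri≈ _ i≡j _ = i≡j
  ... | tri> _ _ j<i = ⊥-elim (not-¬ (subst (λ x → A (r j) x ≡ true) (sym cᵢ≡cⱼ) (diag j)) (upper j i j<i))

  Triangular⇒hasTriangle : ∀ {r : Fin k → Fin m} {c} → Triangular A r c → HasTriangleOfSize A k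
  Triangular⇒hasTriangle {r = r} {c} T =
    r , c , Triangular⇒rows-injective T , Triangular⇒cols-injective T ,
    idₚ , idₚ , Triangular.diag T , Triangular.upper T

  hasTriangle⇒Triangular : HasTriangleOfSize A k →
                           Σ (Fin k → Fin m) λ r → Σ (Fin k → Fin n) λ c → Triangular A r c
  hasTriangle⇒Triangular (r , c , _ , _ , σ , τ , diag , upper) =
    r ∘ (σ ⟨$⟩ʳ_) , c ∘ (τ ⟨$⟩ʳ_) , triangular diag upper

missedBy : (Fin k → Fin n) → Subset n
missedBy {zero}  c = ⊤
missedBy {suc k} c = missedBy (tail c) - head c

∉-image⇒∈missedBy : ∀ (c : Fin k → Fin n) {w} → (∀ j → c j ≢ w) → w ∈ missedBy c
∉-image⇒∈missedBy {zero}  c _   = ∈⊤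
∉-image⇒∈missedBy {suc k} c c≢w = x∈p∧x≢y⇒x∈p-y (∉-image⇒∈missedBy (tail c) (c≢w ∘ suc)) (c≢w zero ∘ sym)

record IsAdjacencyPattern (G : SimpleGraph n) (ℓ : Looping n) (A : Pattern n n) : Set where
  field
    entry⇒nbr : ∀ {v w} → A v w ≡ true → Nbr G ℓ v w
    nbr⇒entry : ∀ {v w} → Nbr G ℓ v w → A v w ≡ true

module _ {G : SimpleGraph n} {ℓ : Looping n} {A : Pattern n n} (adjacency : IsAdjacencyPattern G ℓ A) where
  open IsAdjacencyPattern adjacency

  record TriangleOutside (S : Subset n) (k : ℕ) : Set where
    field
      rows cols    : Fin k → Fin n
      isTriangular : Triangular A rows cols
      cols∉S       : ∀ j → cols j ∉ S

  forces⇒triangle : ∀ {S} (F : Forces G ℓ S ⊤) → TriangleOutside S (steps F)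
  forces⇒triangle done = record { rows = [] ; cols = [] ; isTriangular = triangular (λ ()) (λ ()) ; cols∉S = λ () }
  forces⇒triangle {S} (step (v , u , u∉S , v~u , forced , refl) F) = record
    { rows         = v ∷ rows
    ; cols         = u ∷ cols
    ; isTriangular = Triangular-∷ (nbr⇒entry v~u) A[v,c]≡0 isTriangular
    ; cols∉S       = λ { zero → u∉S ; (suc j) → cols∉S j ∘ p⊆p∪q ⁅ u ⁆ }
    }
    where
    open TriangleOutside (forces⇒triangle F)
    cols≢u : ∀ j → cols j ≢ u
    cols≢u j cⱼ≡u = cols∉S j (subst (_∈ S ∪ ⁅ u ⁆) (sym cⱼ≡u) (q⊆p∪q S ⁅ u ⁆ (x∈⁅x⁆ u)))
    A[v,c]≡0 : ∀ j → A v (cols j) ≡ false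
    A[v,c]≡0 j = ¬-not λ A[v,cⱼ]≡* → cols∉S j (p⊆p∪q ⁅ u ⁆ (forced (cols j) (entry⇒nbr A[v,cⱼ]≡*) (cols≢u j)))

  triangular⇒forces : ∀ {r c : Fin k → Fin n} → Triangular A r c →
                      Σ (Forces G ℓ (missedBy c) ⊤) λ F → steps F ≡ k
  triangular⇒forces {zero} _ = done , refl
  triangular⇒forces {suc k} {r} {c} T@(triangular diag upper) with triangular⇒forces (Triangular-tail T)
  ... | F , steps≡k =
    step (head r , head c , x∉p-x _ (head c) , entry⇒nbr (diag zero) , forced , missed-∪) F , cong suc steps≡k
    where
    c₀∈ : head c ∈ missedBy (tail c)
    c₀∈ = ∉-image⇒∈missedBy (tail c) λ j c₁₊ⱼ≡c₀ → 0≢1+n (sym (Triangular⇒cols-injective T c₁₊ⱼ≡c₀))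
    missed-∪ : missedBy (tail c) ≡ missedBy c ∪ ⁅ head c ⁆
    missed-∪ = sym (x∈p⇒[p-x]∪⁅x⁆≡p c₀∈)
    forced : ∀ w → Nbr G ℓ (head r) w → w ≢ head c → w ∈ missedBy c
    forced w r₀~w w≢c₀ = ∉-image⇒∈missedBy c λ
      { zero    c₀≡w → w≢c₀ (sym c₀≡w)
      ; (suc j) cⱼ≡w →
          not-¬ (nbr⇒entry r₀~w) (subst (λ x → A (head r) x ≡ false) cⱼ≡w (upper zero (suc j) (s≤s z≤n)))
      }

  loopZFS⇒triangle : ∀ {S} → IsLoopZFS G ℓ S → HasTriangleOfSize A (n ∸ ∣ S ∣)
  loopZFS⇒triangle F = subst (HasTriangleOfSize A) (steps≡n∸∣S∣ F) (Triangular⇒hasTriangle isTriangular)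
    where open TriangleOutside (forces⇒triangle F)

  triangle⇒loopZFS : HasTriangleOfSize A k → Σ (Subset n) λ S → IsLoopZFS G ℓ S × k ≡ n ∸ ∣ S ∣
  triangle⇒loopZFS H with hasTriangle⇒Triangular H
  ... | _ , c , T with triangular⇒forces T
  ...   | F , steps≡k = missedBy c , F , trans (sym steps≡k) (steps≡n∸∣S∣ F)

  zeroForcingNumber⇒triangleNumber : ∀ {z} → IsZeroForcingNumber G ℓ z → IsTriangleNumber A (n ∸ z)
  zeroForcingNumber⇒triangleNumber {z} ((S , F , ∣S∣≡z) , z-min) =
    subst (λ s → HasTriangleOfSize A (n ∸ s)) ∣S∣≡z (loopZFS⇒triangle F) , bound
    where
    bound : ∀ k → HasTriangleOfSize A k → k ≤ n ∸ z
    bound k H with triangle⇒loopZFS H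
    ... | S' , F' , k≡n∸∣S'∣ = subst (_≤ n ∸ z) (sym k≡n∸∣S'∣) (∸-monoʳ-≤ n (z-min S' F'))

InSznz⇒IsAdjacencyPattern : ∀ {G : SimpleGraph n} {A ℓ} → InSznz G A → (∀ i → A i i ≡ ℓ i) →
                            IsAdjacencyPattern G ℓ A
InSznz⇒IsAdjacencyPattern {G = G} {A} {ℓ} (_ , A-off) A-diag =
  record { entry⇒nbr = entry⇒nbr ; nbr⇒entry = nbr⇒entry }
  where
  entry⇒nbr : ∀ {v w} → A v w ≡ true → Nbr G ℓ v w
  entry⇒nbr {v} {w} A[v,w]≡* with v ≟ᶠ w
  ... | yes refl = inj₂ (refl , trans (sym (A-diag v)) A[v,w]≡*)
  ... | no v≢w   = inj₁ (trans (sym (A-off v w v≢w)) A[v,w]≡*)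
  nbr⇒entry : ∀ {v w} → Nbr G ℓ v w → A v w ≡ true
  nbr⇒entry (inj₂ (refl , loop)) = trans (A-diag _) loop
  nbr⇒entry {v} {w} (inj₁ v~w) with v ≟ᶠ w
  ... | yes refl = ⊥-elim (not-¬ v~w (irrefl G v))
  ... | no v≢w   = trans (A-off v w v≢w) v~w

loopPattern : SimpleGraph n → Looping n → Pattern n n
loopPattern G ℓ i j = if does (i ≟ᶠ j) then ℓ i else adj G i j

loopPattern-diag : ∀ (G : SimpleGraph n) ℓ i → loopPattern G ℓ i i ≡ ℓ i
loopPattern-diag G ℓ i rewrite dec-true (i ≟ᶠ i) refl = refl

loopPattern∈Sznz : ∀ (G : SimpleGraph n) ℓ → InSznz G (loopPattern G ℓ)
loopPattern∈Sznz G ℓ = symmetric , off-diagonal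
  where
  symmetric : ∀ i j → loopPattern G ℓ i j ≡ loopPattern G ℓ j i
  symmetric i j with i ≟ᶠ j | j ≟ᶠ i
  ... | yes refl | yes _   = refl
  ... | yes refl | no j≢i  = ⊥-elim (j≢i refl)
  ... | no i≢j   | yes refl = ⊥-elim (i≢j refl)
  ... | no _     | no _    = SimpleGraph.sym G i j
  off-diagonal : ∀ i j → i ≢ j → loopPattern G ℓ i j ≡ adj G i j
  off-diagonal i j i≢j rewrite dec-false (i ≟ᶠ j) i≢j = refl

zeroForcingNumber≤n : ∀ {G : SimpleGraph n} {ℓ z} → IsZeroForcingNumber G ℓ z → z ≤ n
zeroForcingNumber≤n {n = n} (_ , z-min) = subst (_ ≤_) (∣⊤∣≡n n) (z-min ⊤ done)

enhancedZ-exists : ∀ (G : SimpleGraph n) → Σ ℕ (IsEnhancedZ G)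
enhancedZ-exists {n} G =
  Z ℓ₀ , (ℓ₀ , Z-spec ℓ₀) , λ ℓ z zfn → subst (_≤ Z ℓ₀) (zeroForcingNumber-unique (Z-spec ℓ) zfn) (Z≤Zℓ₀ ℓ)
  where
  Z : Looping n → ℕ
  Z ℓ = proj₁ (zeroForcingNumber-exists G ℓ)
  Z-spec : ∀ ℓ → IsZeroForcingNumber G ℓ (Z ℓ)
  Z-spec ℓ = proj₂ (zeroForcingNumber-exists G ℓ)
  Z-cong : ∀ {ℓ ℓ'} → ℓ ≗ ℓ' → Z ℓ ≡ Z ℓ'
  Z-cong ℓ≗ℓ' = zeroForcingNumber-unique (zeroForcingNumber-cong ℓ≗ℓ' (Z-spec _)) (Z-spec _)
  ℓ₀ : Looping n
  ℓ₀ = proj₁ (argmax-Fin→Bool n Z Z-cong)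
  Z≤Zℓ₀ : ∀ ℓ → Z ℓ ≤ Z ℓ₀
  Z≤Zℓ₀ = proj₂ (argmax-Fin→Bool n Z Z-cong)

enhancedZ⇒minTri : ∀ {G : SimpleGraph n} {Ẑ} → IsEnhancedZ G Ẑ → IsMinTri G (n ∸ Ẑ)
enhancedZ⇒minTri {n} {G} {Ẑ} ((ℓ₀ , Ẑ-zfn) , Ẑ-max) =
  (loopPattern G ℓ₀ , loopPattern∈Sznz G ℓ₀ , tri-ℓ₀) , minimal
  where
  tri-ℓ₀ : IsTriangleNumber (loopPattern G ℓ₀) (n ∸ Ẑ)
  tri-ℓ₀ = zeroForcingNumber⇒triangleNumber
             (InSznz⇒IsAdjacencyPattern (loopPattern∈Sznz G ℓ₀) (loopPattern-diag G ℓ₀)) Ẑ-zfn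
  minimal : ∀ A t → InSznz G A → IsTriangleNumber A t → n ∸ Ẑ ≤ t
  minimal A t A∈ t-tri with zeroForcingNumber-exists G (λ i → A i i)
  ... | z , z-zfn =
    subst (n ∸ Ẑ ≤_) (triangleNumber-unique {A = A} tri-A t-tri) (∸-monoʳ-≤ n (Ẑ-max _ z z-zfn))
    where
    tri-A : IsTriangleNumber A (n ∸ z)
    tri-A = zeroForcingNumber⇒triangleNumber (InSznz⇒IsAdjacencyPattern A∈ λ _ → refl) z-zfn

theorem2p2 : (n : ℕ) (G : SimpleGraph n) →
    Σ ℕ λ zh → Σ ℕ λ m → IsEnhancedZ G zh × IsMinTri G m × zh ≡ n ∸ m
theorem2p2 n G with enhancedZ-exists G
... | Ẑ , isẐ@((_ , Ẑ-zfn) , _) =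
  Ẑ , n ∸ Ẑ , isẐ , enhancedZ⇒minTri isẐ , sym (m∸[m∸n]≡n (zeroForcingNumber≤n Ẑ-zfn))
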